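{- Let $(\mathbb{C},P)$ be an elementary existential doctrine with singletons. Then the inclusion of $\mathbf{Map}_c(\mathbb{C},P)$ into $\mathbf{Map}(\mathbb{C},P)$ is an equivalence of categories.
   Context: A doctrine is a pair $(\mathbb{C},P)$ with $\mathbb{C}$ a category with finite products and $P:\mathbb{C}^{op}\to\mathbf{ISL}$ a functor into inf-semilattices; write $f^*=P(f)$, $\wedge$ for meets, $\top_A$ for the top of $P(A)$. It is elementary existential if each $f^*$ has a left adjoint $\exists_f$ satisfying Beck–Chevalley for pullbacks and Frobenius reciprocity. Equality on $A$: $\delta_A=\exists_{\Delta_A}\top_A\in P(A\times A)$. Comprehension of $\alpha\in P(A)$: a morphism $\lfloor\alpha\rfloor:X\to A$ with $\top_X\le\lfloor\alpha\rfloor^*\alpha$ through which every $f:Y\to A$ with $\top_Y\le f^*\alpha$ factors uniquely; $f:X\to Y$ has an image if $\exists_f\top_X$ has a comprehension. Power objects: objects $\mathbb{P}(X)$ and $\in_X\in P(X\times\mathbb{P}(X))$ such that each $\gamma\in P(X\times Y)$ equals $(\mathrm{id}_X\times\{\gamma\})^*\in_X$ for a unique $\{\gamma\}:Y\to\mathbb{P}(X)$. A formula $F\in P(Y\times A)$ is a functional relation from $Y$ to $A$ if $F(y,a)\wedge F(y,a')\le\delta_A(a,a')$ and $\exists a{:}A.\,F(y,a)=\top_Y$ (internal-language notation). Internal graph of $f:Y\to A$: $\Gamma f=(f\times\mathrm{id}_A)^*\delta_A$. $\mathbf{Map}(\mathbb{C},P)$ is the category with the objects of $\mathbb{C}$,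 functional relations as morphisms, identities $\delta_A$ and composition $(G\circ F)(a,c)=\exists b{:}B.\,(F(a,b)\wedge G(b,c))$. $A$ is complete if for every $Y$ and every functional relation $F$ from $Y$ to $A$ there is a unique $f:Y\to A$ with $\Gamma f=F$; $\mathbf{Map}_c(\mathbb{C},P)$ is the full subcategory of $\mathbf{Map}(\mathbb{C},P)$ on complete objects. $f:A\to B$ is internally injective if $\delta_A=(f\times f)^*\delta_B$. The doctrine has singletons if (i) it has power objects; (ii) each $\{\delta_A\}:A\to\mathbb{P}(A)$ has an image and is internally injective; (iii) for every $g:Y\to\mathbb{P}(A)$, the formula $(\mathrm{id}_A\times g)^*\in_A$, read as a relation from $Y$ to $A$, is functional iff $g^*(\exists_{\{\delta_A\}}\top_A)=\top_Y$. -}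

module Defs where

open import Level using (Level; _⊔_; suc)
open import Data.Product using (Σ; Σ-syntax; _×_; _,_; proj₁; proj₂)
open import Relation.Binary.Core using (Rel)
open import Relation.Binary.Structures using (IsEquivalence)
open import Relation.Binary.Lattice.Bundles using (BoundedMeetSemilattice)

record Category (o ℓ e : Level) : Set (suc (o ⊔ ℓ ⊔ e)) where
  infixr 9 _∘_
  infix 4 _≈_
  field
    Obj : Set o
    Hom : Obj → Obj → Set ℓ
    _≈_ : ∀ {A B} → Rel (Hom A B) e
    id : ∀ {A} → Hom A A
    _∘_ : ∀ {A B C} → Hom B C → Hom A B → Hom A C
    ≈-equiv : ∀ {A B} → IsEquivalence (_≈_ {A} {B})
    ∘-resp-≈ : ∀ {A B C} {f h : Hom B C} {g i : Hom A B} →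
               f ≈ h → g ≈ i → f ∘ g ≈ h ∘ i
    identityˡ : ∀ {A B} {f : Hom A B} → id ∘ f ≈ f
    identityʳ : ∀ {A B} {f : Hom A B} → f ∘ id ≈ f
    assoc : ∀ {A B C D} {f : Hom A B} {g : Hom B C} {h : Hom C D} →
            (h ∘ g) ∘ f ≈ h ∘ (g ∘ f)

  record IsPullback {A B C Q : Obj} (f : Hom A C) (g : Hom B C)
                    (p₁ : Hom Q A) (p₂ : Hom Q B) : Set (o ⊔ ℓ ⊔ e) where
    field
      commute : f ∘ p₁ ≈ g ∘ p₂
      universal : ∀ {X} (h : Hom X A) (k : Hom X B) → f ∘ h ≈ g ∘ k →
        Σ[ u ∈ Hom X Q ] ((p₁ ∘ u ≈ h) × (p₂ ∘ u ≈ k) ×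
          (∀ (v : Hom X Q) → p₁ ∘ v ≈ h → p₂ ∘ v ≈ k → v ≈ u))

record FinProducts {o ℓ e} (C : Category o ℓ e) : Set (o ⊔ ℓ ⊔ e) where
  open Category C
  infixr 7 _⊗_
  field
    𝟙 : Obj
    ! : ∀ {A} → Hom A 𝟙
    !-unique : ∀ {A} (f : Hom A 𝟙) → f ≈ !
    _⊗_ : Obj → Obj → Obj
    π₁ : ∀ {A B} → Hom (A ⊗ B) A
    π₂ : ∀ {A B} → Hom (A ⊗ B) B
    ⟨_,_⟩ : ∀ {X A B} → Hom X A → Hom X B → Hom X (A ⊗ B)
    project₁ : ∀ {X A B} {f : Hom X A} {g : Hom X B} → π₁ ∘ ⟨ f , g ⟩ ≈ f
    project₂ : ∀ {X A B} {f : Hom X A} {g : Hom X B} → π₂ ∘ ⟨ f , g ⟩ ≈ g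
    unique : ∀ {X A B} {f : Hom X A} {g : Hom X B} {h : Hom X (A ⊗ B)} →
             π₁ ∘ h ≈ f → π₂ ∘ h ≈ g → h ≈ ⟨ f , g ⟩

  _⁂_ : ∀ {A B A' B'} → Hom A B → Hom A' B' → Hom (A ⊗ A') (B ⊗ B')
  f ⁂ g = ⟨ f ∘ π₁ , g ∘ π₂ ⟩

  Δ : ∀ {A} → Hom A (A ⊗ A)
  Δ = ⟨ id , id ⟩

  swap : ∀ {A B} → Hom (A ⊗ B) (B ⊗ A)
  swap = ⟨ π₂ , π₁ ⟩

-- Doctrines: functors C^op → ISL (bounded inf-semilattices,
-- morphisms preserving ∧ and ⊤)

record Doctrine {o ℓ e} (C : Category o ℓ e) (p q r : Level)
       : Set (o ⊔ ℓ ⊔ e ⊔ suc (p ⊔ q ⊔ r)) where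
  open Category C
  field
    P : Obj → BoundedMeetSemilattice p q r

  Pred : Obj → Set p
  Pred A = BoundedMeetSemilattice.Carrier (P A)

  leqP : (A : Obj) → Pred A → Pred A → Set r
  leqP A = BoundedMeetSemilattice._≤_ (P A)
  syntax leqP A x y = x ≤[ A ] y

  eqP : (A : Obj) → Pred A → Pred A → Set q
  eqP A = BoundedMeetSemilattice._≈_ (P A)
  syntax eqP A x y = x ≈[ A ] y

  meetP : (A : Obj) → Pred A → Pred A → Pred A
  meetP A = BoundedMeetSemilattice._∧_ (P A)
  syntax meetP A x y = x ∧[ A ] y

  ⊤[_] : (A : Obj) → Pred A
  ⊤[ A ] = BoundedMeetSemilattice.⊤ (P A)

  infixr 8 _*_
  field
    _*_ : ∀ {A B} → Hom A B → Pred B → Pred A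
    *-cong : ∀ {A B} (f : Hom A B) {x y : Pred B} →
             x ≈[ B ] y → (f * x) ≈[ A ] (f * y)
    *-resp-≈ : ∀ {A B} {f g : Hom A B} (x : Pred B) →
               f ≈ g → (f * x) ≈[ A ] (g * x)
    *-id : ∀ {A} (x : Pred A) → (id * x) ≈[ A ] x
    *-∘ : ∀ {A B C} (f : Hom A B) (g : Hom B C) (x : Pred C) →
          ((g ∘ f) * x) ≈[ A ] (f * (g * x))
    *-∧ : ∀ {A B} (f : Hom A B) (x y : Pred B) →
          (f * (x ∧[ B ] y)) ≈[ A ] ((f * x) ∧[ A ] (f * y))
    *-⊤ : ∀ {A B} (f : Hom A B) → (f * ⊤[ B ]) ≈[ A ] ⊤[ A ]

record ElementaryExistential {o ℓ e p q r} (C : Category o ℓ e)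
       (D : Doctrine C p q r) : Set (o ⊔ ℓ ⊔ e ⊔ p ⊔ q ⊔ r) where
  open Category C
  open Doctrine D
  field
    Ex : ∀ {A B} → Hom A B → Pred A → Pred B
    Ex-adj₁ : ∀ {A B} (f : Hom A B) (x : Pred A) (y : Pred B) →
              (Ex f x) ≤[ B ] y → x ≤[ A ] (f * y)
    Ex-adj₂ : ∀ {A B} (f : Hom A B) (x : Pred A) (y : Pred B) →
              x ≤[ A ] (f * y) → (Ex f x) ≤[ B ] y
    beck-chevalley : ∀ {A B C' Q} (f : Hom A C') (g : Hom B C')
                     (p₁ : Hom Q A) (p₂ : Hom Q B) → IsPullback f g p₁ p₂ →
                     ∀ (x : Pred A) → (g * Ex f x) ≈[ B ] (Ex p₂ (p₁ * x))
    frobenius : ∀ {A B} (f : Hom A B) (x : Pred A) (y : Pred B) →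
                (Ex f ((f * y) ∧[ A ] x)) ≈[ B ] (y ∧[ B ] Ex f x)

module Theory {o ℓ e p q r} {C : Category o ℓ e} (FP : FinProducts C)
       {D : Doctrine C p q r} (EE : ElementaryExistential C D) where
  open Category C
  open FinProducts FP
  open Doctrine D
  open ElementaryExistential EE

  δ : (A : Obj) → Pred (A ⊗ A)
  δ A = Ex (Δ {A}) ⊤[ A ]

  Γ : ∀ {Y A} → Hom Y A → Pred (Y ⊗ A)
  Γ {Y} {A} f = (f ⁂ id {A}) * δ A

  -- F(y,a) ∧ F(y,a') ≤ δ_A(a,a')   and   ∃a:A. F(y,a) = ⊤_Y
  IsFunctional : (Y A : Obj) → Pred (Y ⊗ A) → Set (q ⊔ r)
  IsFunctional Y A F =
    (((⟨ π₁ , π₁ ∘ π₂ ⟩ * F) ∧[ Y ⊗ (A ⊗ A) ] (⟨ π₁ , π₂ ∘ π₂ ⟩ * F))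
       ≤[ Y ⊗ (A ⊗ A) ] (⟨ π₁ ∘ π₂ {Y} , π₂ ∘ π₂ {Y} ⟩ * δ A))
    × (Ex (π₁ {Y} {A}) F ≈[ Y ] ⊤[ Y ])

  -- relational composition  (G∘F)(a,c) = ∃b:B. F(a,b) ∧ G(b,c)
  compose : ∀ {A B C'} → Pred (B ⊗ C') → Pred (A ⊗ B) → Pred (A ⊗ C')
  compose {A} {B} {C'} G F =
    Ex {A ⊗ (B ⊗ C')} {A ⊗ C'} ⟨ π₁ , π₂ ∘ π₂ ⟩
       ((⟨ π₁ , π₁ ∘ π₂ ⟩ * F) ∧[ A ⊗ (B ⊗ C') ] (π₂ * G))

  IsComplete : Obj → Set (o ⊔ ℓ ⊔ e ⊔ p ⊔ q ⊔ r)
  IsComplete A = ∀ (Y : Obj) (F : Pred (Y ⊗ A)) → IsFunctional Y A F →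
    Σ[ f ∈ Hom Y A ] ((Γ f ≈[ Y ⊗ A ] F) ×
      (∀ (g : Hom Y A) → Γ g ≈[ Y ⊗ A ] F → g ≈ f))

  record Comprehension {A : Obj} (α : Pred A) : Set (o ⊔ ℓ ⊔ e ⊔ r) where
    field
      X : Obj
      ⌊α⌋ : Hom X A
      ⌊α⌋-⊤ : ⊤[ X ] ≤[ X ] (⌊α⌋ * α)
      factor : ∀ {Y} (f : Hom Y A) → ⊤[ Y ] ≤[ Y ] (f * α) →
        Σ[ u ∈ Hom Y X ] ((⌊α⌋ ∘ u ≈ f) × (∀ (v : Hom Y X) → ⌊α⌋ ∘ v ≈ f → v ≈ u))

  HasImage : ∀ {A B} → Hom A B → Set (o ⊔ ℓ ⊔ e ⊔ r)
  HasImage {A} f = Comprehension (Ex f ⊤[ A ])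

  InternallyInjective : ∀ {A B} → Hom A B → Set q
  InternallyInjective {A} {B} f = δ A ≈[ A ⊗ A ] ((f ⁂ f) * δ B)

  record PowerObjects : Set (o ⊔ ℓ ⊔ e ⊔ p ⊔ q) where
    field
      ℙ : Obj → Obj
      ∈ : (X : Obj) → Pred (X ⊗ ℙ X)
      ⦅_⦆ : ∀ {X Y} → Pred (X ⊗ Y) → Hom Y (ℙ X)
      ⦅⦆-spec : ∀ {X Y} (γ : Pred (X ⊗ Y)) →
                γ ≈[ X ⊗ Y ] ((id ⁂ ⦅ γ ⦆) * ∈ X)
      ⦅⦆-unique : ∀ {X Y} (γ : Pred (X ⊗ Y)) (g : Hom Y (ℙ X)) →
                  γ ≈[ X ⊗ Y ] ((id ⁂ g) * ∈ X) → g ≈ ⦅ γ ⦆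

  record HasSingletons : Set (o ⊔ ℓ ⊔ e ⊔ p ⊔ q ⊔ r) where
    field
      powerObjects : PowerObjects
    open PowerObjects powerObjects
    sing : (A : Obj) → Hom A (ℙ A)
    sing A = ⦅ δ A ⦆
    field
      sing-image : ∀ A → HasImage (sing A)
      sing-injective : ∀ A → InternallyInjective (sing A)
      sing-functional⇒ : ∀ {A Y} (g : Hom Y (ℙ A)) →
        IsFunctional Y A (swap * ((id ⁂ g) * ∈ A)) →
        (g * Ex (sing A) ⊤[ A ]) ≈[ Y ] ⊤[ Y ]
      sing-functional⇐ : ∀ {A Y} (g : Hom Y (ℙ A)) →
        (g * Ex (sing A) ⊤[ A ]) ≈[ Y ] ⊤[ Y ] →
        IsFunctional Y A (swap * ((id ⁂ g) * ∈ A))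

-- Categories presented by raw arrows, an identity/composition on raw
-- arrows, and a predicate singling out the actual morphisms.
-- (Used for Map(C,P): morphisms are functional relations, identity is δ,
-- composition is relational composition; closure of functional relations
-- under these operations is a theorem, not part of the presentation.)

record RawCategory (o a e h : Level) : Set (suc (o ⊔ a ⊔ e ⊔ h)) where
  infixr 9 _∘_
  infix 4 _≈_
  field
    Obj : Set o
    Arr : Obj → Obj → Set a
    _≈_ : ∀ {A B} → Arr A B → Arr A B → Set e
    id : ∀ {A} → Arr A A
    _∘_ : ∀ {A B C} → Arr B C → Arr A B → Arr A C
    IsHom : ∀ {A B} → Arr A B → Set h

record IsEquivalenceOfCategories
       {o₁ a₁ e₁ h₁ o₂ a₂ e₂ h₂}
       (𝔻 : RawCategory o₁ a₁ e₁ h₁) (𝔼 : RawCategory o₂ a₂ e₂ h₂)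
       (F₀ : RawCategory.Obj 𝔻 → RawCategory.Obj 𝔼)
       (F₁ : ∀ {A B} → RawCategory.Arr 𝔻 A B → RawCategory.Arr 𝔼 (F₀ A) (F₀ B))
       (F-hom : ∀ {A B} {f : RawCategory.Arr 𝔻 A B} →
                RawCategory.IsHom 𝔻 f → RawCategory.IsHom 𝔼 (F₁ f))
       : Set (o₁ ⊔ a₁ ⊔ e₁ ⊔ h₁ ⊔ o₂ ⊔ a₂ ⊔ e₂ ⊔ h₂) where
  private
    module D = RawCategory 𝔻
    module E = RawCategory 𝔼
  field
    G₀ : E.Obj → D.Obj
    G₁ : ∀ {A B} (f : E.Arr A B) → E.IsHom f → D.Arr (G₀ A) (G₀ B)
    G-hom : ∀ {A B} (f : E.Arr A B) (p : E.IsHom f) → D.IsHom (G₁ f p)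
    G-resp-≈ : ∀ {A B} (f g : E.Arr A B) (p : E.IsHom f) (p' : E.IsHom g) →
               f E.≈ g → G₁ f p D.≈ G₁ g p'
    G-identity : ∀ {A} (p : E.IsHom (E.id {A})) → G₁ E.id p D.≈ D.id
    G-homomorphism : ∀ {A B C} (f : E.Arr A B) (g : E.Arr B C)
                     (p : E.IsHom f) (p' : E.IsHom g) (p'' : E.IsHom (g E.∘ f)) →
                     G₁ (g E.∘ f) p'' D.≈ (G₁ g p' D.∘ G₁ f p)
    η : ∀ A → D.Arr A (G₀ (F₀ A))
    η⁻¹ : ∀ A → D.Arr (G₀ (F₀ A)) A
    η-hom : ∀ A → D.IsHom (η A)
    η⁻¹-hom : ∀ A → D.IsHom (η⁻¹ A)
    η-isoˡ : ∀ A → (η⁻¹ A D.∘ η A) D.≈ D.id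
    η-isoʳ : ∀ A → (η A D.∘ η⁻¹ A) D.≈ D.id
    η-natural : ∀ {A B} (f : D.Arr A B) (p : D.IsHom f) →
                (η B D.∘ f) D.≈ (G₁ (F₁ f) (F-hom p) D.∘ η A)
    ε : ∀ B → E.Arr (F₀ (G₀ B)) B
    ε⁻¹ : ∀ B → E.Arr B (F₀ (G₀ B))
    ε-hom : ∀ B → E.IsHom (ε B)
    ε⁻¹-hom : ∀ B → E.IsHom (ε⁻¹ B)
    ε-isoˡ : ∀ B → (ε⁻¹ B E.∘ ε B) E.≈ E.id
    ε-isoʳ : ∀ B → (ε B E.∘ ε⁻¹ B) E.≈ E.id
    ε-natural : ∀ {A B} (g : E.Arr A B) (p : E.IsHom g) →
                (g E.∘ ε A) E.≈ (ε B E.∘ F₁ (G₁ g p))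

module _ {o ℓ e p q r} {C : Category o ℓ e} (FP : FinProducts C)
         {D : Doctrine C p q r} (EE : ElementaryExistential C D) where
  open Category C using (Obj)
  open FinProducts FP using (_⊗_)
  open Doctrine D using (Pred; eqP)
  open Theory FP EE

  Map : RawCategory o p q (q ⊔ r)
  Map = record
    { Obj = Obj
    ; Arr = λ A B → Pred (A ⊗ B)
    ; _≈_ = λ {A} {B} F G → F ≈[ A ⊗ B ] G
    ; id = λ {A} → δ A
    ; _∘_ = compose
    ; IsHom = λ {A} {B} F → IsFunctional A B F
    }

  Mapc : RawCategory (o ⊔ ℓ ⊔ e ⊔ p ⊔ q ⊔ r) p q (q ⊔ r)
  Mapc = record
    { Obj = Σ Obj IsComplete
    ; Arr = λ A B → Pred (proj₁ A ⊗ proj₁ B)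
    ; _≈_ = λ {A} {B} F G → F ≈[ proj₁ A ⊗ proj₁ B ] G
    ; id = λ {A} → δ (proj₁ A)
    ; _∘_ = compose
    ; IsHom = λ {A} {B} F → IsFunctional (proj₁ A) (proj₁ B) F
    }

  InclusionIsEquivalence : Set (o ⊔ ℓ ⊔ e ⊔ p ⊔ q ⊔ r)
  InclusionIsEquivalence =
    IsEquivalenceOfCategories Mapc Map proj₁ (λ F → F) (λ φ → φ)

module Submission where

-- Every object A is isomorphic in Map(C,P) to a complete object, namely the
-- image X_A of the singleton map {δ_A} : A → ℙ(A).  Factoring {δ_A} through
-- its comprehension ι : X_A → ℙ(A) gives s : A → X_A which is internally
-- surjective (∃_s ⊤ = ⊤) and internally injective, so the graph η_A of s is
-- an isomorphism in Map(C,P) whose inverse ε_A is the converse graph.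
-- X_A is complete: a functional F from Y to X_A gives the functional
-- H = ε_A ∘ F from Y to A; its classifying map g : Y → ℙ(A) satisfies
-- g*(∃_{δ} ⊤) = ⊤ by the singleton axiom, so it factors through ι as f, and
-- Γf = F.  The quasi-inverse of the inclusion sends A to X_A and a
-- functional F to η ∘ F ∘ ε; its functoriality and the naturality of η, ε
-- are then pure associativity/unit computations in the relational calculus.

open import Level using (Level)
open import Data.Product using (Σ-syntax; _×_; _,_; proj₁; proj₂)
open import Relation.Binary.Structures using (IsEquivalence)
open import Relation.Binary.Bundles using (Setoid)
open import Relation.Binary.Lattice.Bundles using (BoundedMeetSemilattice)
import Relation.Binary.Reasoning.Setoid as SetoidReasoning
open import Defs

module Development {o ℓ e p q r : Level} (C : Category o ℓ e) (FP : FinProducts C)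
                   (D : Doctrine C p q r) (EE : ElementaryExistential C D) where
  open Category C
  open FinProducts FP
  open Doctrine D
  open ElementaryExistential EE
  open Theory FP EE

  hrefl : ∀ {A B} {f : Hom A B} → f ≈ f
  hrefl = IsEquivalence.refl ≈-equiv

  hsym : ∀ {A B} {f g : Hom A B} → f ≈ g → g ≈ f
  hsym = IsEquivalence.sym ≈-equiv

  htrans : ∀ {A B} {f g h : Hom A B} → f ≈ g → g ≈ h → f ≈ h
  htrans = IsEquivalence.trans ≈-equiv

  homSetoid : Obj → Obj → Setoid ℓ e
  homSetoid A B = record { Carrier = Hom A B ; _≈_ = _≈_ ; isEquivalence = ≈-equiv }

  module HomReasoning {A B : Obj} = SetoidReasoning (homSetoid A B)

  ∘ˡ : ∀ {A B C'} {f : Hom B C'} {g h : Hom A B} → g ≈ h → f ∘ g ≈ f ∘ h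
  ∘ˡ p = ∘-resp-≈ hrefl p

  ∘ʳ : ∀ {A B C'} {f g : Hom B C'} {h : Hom A B} → f ≈ g → f ∘ h ≈ g ∘ h
  ∘ʳ p = ∘-resp-≈ p hrefl

  sym-assoc : ∀ {A B C' D'} {f : Hom A B} {g : Hom B C'} {h : Hom C' D'} →
              h ∘ (g ∘ f) ≈ (h ∘ g) ∘ f
  sym-assoc = hsym assoc

  assoc₃ : ∀ {A B C' D' E'} {f : Hom D' E'} {g : Hom C' D'} {h : Hom B C'} {k : Hom A B} →
           (f ∘ g ∘ h) ∘ k ≈ f ∘ g ∘ h ∘ k
  assoc₃ = htrans assoc (∘ˡ assoc)

  ⟨⟩-cong : ∀ {X A B} {f f' : Hom X A} {g g' : Hom X B} → f ≈ f' → g ≈ g' →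
            ⟨ f , g ⟩ ≈ ⟨ f' , g' ⟩
  ⟨⟩-cong p q = unique (htrans project₁ p) (htrans project₂ q)

  ⊗-ext : ∀ {X A B} {h k : Hom X (A ⊗ B)} → π₁ ∘ h ≈ π₁ ∘ k → π₂ ∘ h ≈ π₂ ∘ k → h ≈ k
  ⊗-ext p q = htrans (unique p q) (hsym (unique hrefl hrefl))

  ⟨⟩-η : ∀ {X A B} {h : Hom X (A ⊗ B)} → ⟨ π₁ ∘ h , π₂ ∘ h ⟩ ≈ h
  ⟨⟩-η = hsym (unique hrefl hrefl)

  ⟨⟩-id : ∀ {A B} → ⟨ π₁ , π₂ ⟩ ≈ id {A ⊗ B}
  ⟨⟩-id = hsym (unique identityʳ identityʳ)

  project₁∘ : ∀ {Y X A B} {f : Hom X A} {g : Hom X B} {h : Hom Y X} → π₁ ∘ ⟨ f , g ⟩ ∘ h ≈ f ∘ h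
  project₁∘ = htrans sym-assoc (∘ʳ project₁)

  project₂∘ : ∀ {Y X A B} {f : Hom X A} {g : Hom X B} {h : Hom Y X} → π₂ ∘ ⟨ f , g ⟩ ∘ h ≈ g ∘ h
  project₂∘ = htrans sym-assoc (∘ʳ project₂)

  ⟨⟩∘ : ∀ {Y X A B} {f : Hom X A} {g : Hom X B} {h : Hom Y X} → ⟨ f , g ⟩ ∘ h ≈ ⟨ f ∘ h , g ∘ h ⟩
  ⟨⟩∘ = unique project₁∘ project₂∘

  ⁂∘⟨⟩ : ∀ {X A B A' B'} {f : Hom A A'} {g : Hom B B'} {h : Hom X A} {k : Hom X B} →
         (f ⁂ g) ∘ ⟨ h , k ⟩ ≈ ⟨ f ∘ h , g ∘ k ⟩
  ⁂∘⟨⟩ = htrans ⟨⟩∘ (⟨⟩-cong (htrans assoc (∘ˡ project₁)) (htrans assoc (∘ˡ project₂)))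

  ⁂-cong : ∀ {A B A' B'} {f f' : Hom A A'} {g g' : Hom B B'} → f ≈ f' → g ≈ g' → (f ⁂ g) ≈ (f' ⁂ g')
  ⁂-cong a b = ⟨⟩-cong (∘ʳ a) (∘ʳ b)

  ⁂∘⁂ : ∀ {A B A' B' A'' B''} {f : Hom A' A''} {g : Hom B' B''} {h : Hom A A'} {k : Hom B B'} →
        (f ⁂ g) ∘ (h ⁂ k) ≈ ((f ∘ h) ⁂ (g ∘ k))
  ⁂∘⁂ = htrans ⁂∘⟨⟩ (⟨⟩-cong sym-assoc sym-assoc)

  ⁂∘Δ : ∀ {A B} {f : Hom A B} → (f ⁂ f) ∘ Δ ≈ Δ ∘ f
  ⁂∘Δ = htrans ⁂∘⟨⟩ (htrans (⟨⟩-cong identityʳ identityʳ)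
                            (hsym (htrans ⟨⟩∘ (⟨⟩-cong identityˡ identityˡ))))

  swap∘⟨⟩ : ∀ {X A B} {f : Hom X A} {g : Hom X B} → swap ∘ ⟨ f , g ⟩ ≈ ⟨ g , f ⟩
  swap∘⟨⟩ = htrans ⟨⟩∘ (⟨⟩-cong project₂ project₁)

  swap∘swap : ∀ {A B} → swap ∘ swap ≈ id {A ⊗ B}
  swap∘swap = htrans swap∘⟨⟩ ⟨⟩-id

  module SL (A : Obj) = BoundedMeetSemilattice (P A)

  infix 4 _⊑_ _≋_
  infixr 7 _⊓_

  _⊑_ : ∀ {A} → Pred A → Pred A → Set r
  _⊑_ {A} = SL._≤_ A

  _≋_ : ∀ {A} → Pred A → Pred A → Set q
  _≋_ {A} = SL._≈_ A

  _⊓_ : ∀ {A} → Pred A → Pred A → Pred A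
  _⊓_ {A} = SL._∧_ A

  ⊤' : ∀ {A} → Pred A
  ⊤' {A} = ⊤[ A ]

  ⊑-refl : ∀ {A} {x : Pred A} → x ⊑ x
  ⊑-refl {A} = SL.refl A

  ⊑-trans : ∀ {A} {x y z : Pred A} → x ⊑ y → y ⊑ z → x ⊑ z
  ⊑-trans {A} = SL.trans A

  ⊑-antisym : ∀ {A} {x y : Pred A} → x ⊑ y → y ⊑ x → x ≋ y
  ⊑-antisym {A} = SL.antisym A

  ≋-refl : ∀ {A} {x : Pred A} → x ≋ x
  ≋-refl {A} = SL.Eq.refl A

  ≋-sym : ∀ {A} {x y : Pred A} → x ≋ y → y ≋ x
  ≋-sym {A} = SL.Eq.sym A

  ≋-trans : ∀ {A} {x y z : Pred A} → x ≋ y → y ≋ z → x ≋ z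
  ≋-trans {A} = SL.Eq.trans A

  ≋⇒⊑ : ∀ {A} {x y : Pred A} → x ≋ y → x ⊑ y
  ≋⇒⊑ {A} = SL.reflexive A

  ≋⇒⊒ : ∀ {A} {x y : Pred A} → x ≋ y → y ⊑ x
  ≋⇒⊒ p = ≋⇒⊑ (≋-sym p)

  predSetoid : Obj → Setoid p q
  predSetoid A = record { Carrier = Pred A ; _≈_ = _≋_ ; isEquivalence = SL.isEquivalence A }

  module PredReasoning {A : Obj} = SetoidReasoning (predSetoid A)

  ⊓-l : ∀ {A} {x y : Pred A} → x ⊓ y ⊑ x
  ⊓-l {A} = SL.x∧y≤x A _ _

  ⊓-r : ∀ {A} {x y : Pred A} → x ⊓ y ⊑ y
  ⊓-r {A} = SL.x∧y≤y A _ _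

  ⊓-glb : ∀ {A} {x y z : Pred A} → x ⊑ y → x ⊑ z → x ⊑ y ⊓ z
  ⊓-glb {A} = SL.∧-greatest A

  ⊤-max : ∀ {A} {x : Pred A} → x ⊑ ⊤'
  ⊤-max {A} {x} = SL.maximum A x

  ⊤-unique : ∀ {A} {x : Pred A} → ⊤' ⊑ x → x ≋ ⊤'
  ⊤-unique h = ⊑-antisym ⊤-max h

  ⊓-mono : ∀ {A} {x x' y y' : Pred A} → x ⊑ x' → y ⊑ y' → x ⊓ y ⊑ x' ⊓ y'
  ⊓-mono a b = ⊓-glb (⊑-trans ⊓-l a) (⊑-trans ⊓-r b)

  ⊓-cong : ∀ {A} {x x' y y' : Pred A} → x ≋ x' → y ≋ y' → x ⊓ y ≋ x' ⊓ y'
  ⊓-cong a b = ⊑-antisym (⊓-mono (≋⇒⊑ a) (≋⇒⊑ b)) (⊓-mono (≋⇒⊒ a) (≋⇒⊒ b))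

  ⊓-comm : ∀ {A} {x y : Pred A} → x ⊓ y ≋ y ⊓ x
  ⊓-comm = ⊑-antisym (⊓-glb ⊓-r ⊓-l) (⊓-glb ⊓-r ⊓-l)

  ⊓-⊤ : ∀ {A} {x : Pred A} → x ⊓ ⊤' ≋ x
  ⊓-⊤ = ⊑-antisym ⊓-l (⊓-glb ⊑-refl ⊤-max)

  ⊓-rotate : ∀ {A} {x y z : Pred A} → x ⊓ (y ⊓ z) ≋ y ⊓ (z ⊓ x)
  ⊓-rotate = ⊑-antisym (⊓-glb (⊑-trans ⊓-r ⊓-l) (⊓-glb (⊑-trans ⊓-r ⊓-r) ⊓-l))
                       (⊓-glb (⊑-trans ⊓-r ⊓-r) (⊓-glb ⊓-l (⊑-trans ⊓-r ⊓-l)))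

  *-mono : ∀ {A B} (f : Hom A B) {x y : Pred B} → x ⊑ y → f * x ⊑ f * y
  *-mono f {x} {y} h =
    ⊑-trans (≋⇒⊑ (*-cong f (⊑-antisym (⊓-glb ⊑-refl h) ⊓-l)))
            (⊑-trans (≋⇒⊑ (*-∧ f x y)) ⊓-r)

  *-≋ : ∀ {A B} {f : Hom A B} {x y : Pred B} → x ≋ y → f * x ≋ f * y
  *-≋ {f = f} h = *-cong f h

  *-≈ : ∀ {A B} {f g : Hom A B} {x : Pred B} → f ≈ g → f * x ≋ g * x
  *-≈ {x = x} h = *-resp-≈ x h

  *-fuse : ∀ {A B C'} {f : Hom A B} {g : Hom B C'} {x : Pred C'} → f * (g * x) ≋ (g ∘ f) * x
  *-fuse {f = f} {g} {x} = ≋-sym (*-∘ f g x)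

  *-fuse₃ : ∀ {A B C' D'} {f : Hom A B} {g : Hom B C'} {h : Hom C' D'} {x : Pred D'} →
            f * (g * (h * x)) ≋ ((h ∘ g) ∘ f) * x
  *-fuse₃ = ≋-trans (*-≋ *-fuse) *-fuse

  *-id≈ : ∀ {A} {h : Hom A A} {x : Pred A} → h ≈ id → h * x ≋ x
  *-id≈ {x = x} e = ≋-trans (*-≈ e) (*-id x)

  *⊤ : ∀ {A B} {f : Hom A B} → f * ⊤' ≋ ⊤'
  *⊤ {f = f} = *-⊤ f

  *⊓ : ∀ {A B} {f : Hom A B} {x y : Pred B} → f * (x ⊓ y) ≋ f * x ⊓ f * y
  *⊓ {f = f} {x} {y} = *-∧ f x y

  unit : ∀ {A B} (f : Hom A B) {x : Pred A} → x ⊑ f * Ex f x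
  unit f {x} = Ex-adj₁ f x (Ex f x) ⊑-refl

  Ex-mono : ∀ {A B} (f : Hom A B) {x y : Pred A} → x ⊑ y → Ex f x ⊑ Ex f y
  Ex-mono f h = Ex-adj₂ f _ _ (⊑-trans h (unit f))

  Ex-≋ : ∀ {A B} {f : Hom A B} {x y : Pred A} → x ≋ y → Ex f x ≋ Ex f y
  Ex-≋ {f = f} h = ⊑-antisym (Ex-mono f (≋⇒⊑ h)) (Ex-mono f (≋⇒⊒ h))

  Ex-≈ : ∀ {A B} {f g : Hom A B} {x : Pred A} → f ≈ g → Ex f x ≋ Ex g x
  Ex-≈ {f = f} {g} h =
    ⊑-antisym (Ex-adj₂ f _ _ (⊑-trans (unit g) (≋⇒⊑ (*-≈ (hsym h)))))
              (Ex-adj₂ g _ _ (⊑-trans (unit f) (≋⇒⊑ (*-≈ h))))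

  -- ∃ is functorial, as the left adjoint of a functor
  Ex∘ : ∀ {A B C'} {f : Hom A B} {g : Hom B C'} {x : Pred A} → Ex (g ∘ f) x ≋ Ex g (Ex f x)
  Ex∘ {f = f} {g} =
    ⊑-antisym (Ex-adj₂ (g ∘ f) _ _
                (⊑-trans (unit f) (⊑-trans (*-mono f (unit g)) (≋⇒⊑ *-fuse))))
              (Ex-adj₂ g _ _ (Ex-adj₂ f _ _
                (⊑-trans (unit (g ∘ f)) (≋⇒⊑ (≋-sym *-fuse)))))

  Ex-id : ∀ {A} {x : Pred A} → Ex id x ≋ x
  Ex-id {x = x} = ⊑-antisym (Ex-adj₂ id _ _ (≋⇒⊒ (*-id x))) (⊑-trans (unit id) (≋⇒⊑ (*-id _)))

  Ex-id≈ : ∀ {A} {h : Hom A A} {x : Pred A} → h ≈ id → Ex h x ≋ x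
  Ex-id≈ e = ≋-trans (Ex-≈ e) Ex-id

  Ex-iso : ∀ {A B} {σ : Hom A B} {τ : Hom B A} → σ ∘ τ ≈ id → τ ∘ σ ≈ id →
           ∀ {x : Pred A} → Ex σ x ≋ τ * x
  Ex-iso {σ = σ} {τ} στ τσ =
    ⊑-antisym (Ex-adj₂ σ _ _ (≋⇒⊒ (≋-trans *-fuse (*-id≈ τσ))))
              (⊑-trans (*-mono τ (unit σ)) (≋⇒⊑ (≋-trans *-fuse (*-id≈ στ))))

  Ex-reindex-iso : ∀ {W₁ W₂ T} {σ : Hom W₂ W₁} {σ' : Hom W₁ W₂} → σ ∘ σ' ≈ id → σ' ∘ σ ≈ id →
                   ∀ (h : Hom W₁ T) (y : Pred W₁) → Ex h y ≋ Ex (h ∘ σ) (σ * y)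
  Ex-reindex-iso σσ' σ'σ h y =
    ≋-sym (≋-trans Ex∘ (Ex-≋ (≋-trans (Ex-iso σσ' σ'σ) (≋-trans *-fuse (*-id≈ σσ')))))

  frob : ∀ {A B} (f : Hom A B) {x : Pred A} {y : Pred B} →
         Ex f (f * y ⊓ x) ≋ y ⊓ Ex f x
  frob f {x} {y} = frobenius f x y

  frob⊤ : ∀ {A B} (f : Hom A B) {y : Pred B} → y ⊓ Ex f ⊤' ≋ Ex f (f * y)
  frob⊤ f = ≋-trans (≋-sym (frob f)) (Ex-≋ ⊓-⊤)

  pAB : ∀ {A B C'} → Hom (A ⊗ (B ⊗ C')) (A ⊗ B)
  pAB = ⟨ π₁ , π₁ ∘ π₂ ⟩

  pAC : ∀ {A B C'} → Hom (A ⊗ (B ⊗ C')) (A ⊗ C')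
  pAC = ⟨ π₁ , π₂ ∘ π₂ ⟩

  module PullbackAlongPAB {Z A B Cc : Obj} (k : Hom Z (A ⊗ B)) where
    k⊗C : Hom (Z ⊗ Cc) (A ⊗ (B ⊗ Cc))
    k⊗C = ⟨ π₁ ∘ k ∘ π₁ , ⟨ π₂ ∘ k ∘ π₁ , π₂ ⟩ ⟩

    isPullback : IsPullback k (pAB {A} {B} {Cc}) π₁ k⊗C
    isPullback = record { commute = commute ; universal = universal }
      where
      open HomReasoning
      commute : k ∘ π₁ ≈ pAB ∘ k⊗C
      commute = ⊗-ext (hsym (htrans project₁∘ project₁))
                      (hsym (begin
                        π₂ ∘ pAB ∘ k⊗C   ≈⟨ project₂∘ ⟩
                        (π₁ ∘ π₂) ∘ k⊗C  ≈⟨ htrans assoc (∘ˡ project₂) ⟩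
                        π₁ ∘ ⟨ π₂ ∘ k ∘ π₁ , π₂ ⟩ ≈⟨ project₁ ⟩
                        π₂ ∘ k ∘ π₁ ∎))
      universal : ∀ {X} (h : Hom X Z) (m : Hom X (A ⊗ (B ⊗ Cc))) → k ∘ h ≈ pAB ∘ m →
                  Σ[ u ∈ Hom X (Z ⊗ Cc) ] ((π₁ ∘ u ≈ h) × (k⊗C ∘ u ≈ m) ×
                    (∀ (v : Hom X (Z ⊗ Cc)) → π₁ ∘ v ≈ h → k⊗C ∘ v ≈ m → v ≈ u))
      universal {X} h m eq = u , project₁ , k⊗C∘u , uniq
        where
        u : Hom X (Z ⊗ Cc)
        u = ⟨ h , π₂ ∘ π₂ ∘ m ⟩
        through-k : ∀ {T} (t : Hom (A ⊗ B) T) → (t ∘ k ∘ π₁) ∘ u ≈ t ∘ pAB ∘ m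
        through-k t = htrans assoc₃ (∘ˡ (htrans (∘ˡ project₁) eq))
        k⊗C∘u : k⊗C ∘ u ≈ m
        k⊗C∘u = ⊗-ext
          (begin
            π₁ ∘ k⊗C ∘ u      ≈⟨ project₁∘ ⟩
            (π₁ ∘ k ∘ π₁) ∘ u ≈⟨ through-k π₁ ⟩
            π₁ ∘ pAB ∘ m      ≈⟨ project₁∘ ⟩
            π₁ ∘ m ∎)
          (begin
            π₂ ∘ k⊗C ∘ u ≈⟨ project₂∘ ⟩
            ⟨ π₂ ∘ k ∘ π₁ , π₂ ⟩ ∘ u ≈⟨ ⊗-ext
              (begin
                π₁ ∘ ⟨ π₂ ∘ k ∘ π₁ , π₂ ⟩ ∘ u ≈⟨ project₁∘ ⟩
                (π₂ ∘ k ∘ π₁) ∘ u ≈⟨ through-k π₂ ⟩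
                π₂ ∘ pAB ∘ m      ≈⟨ project₂∘ ⟩
                (π₁ ∘ π₂) ∘ m     ≈⟨ assoc ⟩
                π₁ ∘ π₂ ∘ m ∎)
              (htrans project₂∘ project₂) ⟩
            π₂ ∘ m ∎)
        uniq : ∀ (v : Hom X (Z ⊗ Cc)) → π₁ ∘ v ≈ h → k⊗C ∘ v ≈ m → v ≈ u
        uniq v e₁ e₂ = unique e₁ (begin
          π₂ ∘ v ≈⟨ ∘ʳ (hsym project₂) ⟩
          (π₂ ∘ ⟨ π₂ ∘ k ∘ π₁ , π₂ ⟩) ∘ v ≈⟨ assoc ⟩
          π₂ ∘ ⟨ π₂ ∘ k ∘ π₁ , π₂ ⟩ ∘ v   ≈⟨ ∘ˡ (hsym project₂∘) ⟩
          π₂ ∘ π₂ ∘ k⊗C ∘ v              ≈⟨ ∘ˡ (∘ˡ e₂) ⟩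
          π₂ ∘ π₂ ∘ m ∎)

    beck-chevalley-pAB : ∀ (x : Pred Z) → pAB * Ex k x ≋ Ex k⊗C (π₁ * x)
    beck-chevalley-pAB x = beck-chevalley k pAB π₁ k⊗C isPullback x

  module PullbackAlongπ₂ {Z W A : Obj} (k : Hom Z W) where
    A⊗k : Hom (A ⊗ Z) (A ⊗ W)
    A⊗k = ⟨ π₁ , k ∘ π₂ ⟩

    isPullback : IsPullback k (π₂ {A} {W}) π₂ A⊗k
    isPullback = record { commute = hsym project₂ ; universal = universal }
      where
      open HomReasoning
      universal : ∀ {X} (h : Hom X Z) (m : Hom X (A ⊗ W)) → k ∘ h ≈ π₂ ∘ m →
                  Σ[ u ∈ Hom X (A ⊗ Z) ] ((π₂ ∘ u ≈ h) × (A⊗k ∘ u ≈ m) ×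
                    (∀ (v : Hom X (A ⊗ Z)) → π₂ ∘ v ≈ h → A⊗k ∘ v ≈ m → v ≈ u))
      universal {X} h m eq = u , project₂ , A⊗k∘u , uniq
        where
        u : Hom X (A ⊗ Z)
        u = ⟨ π₁ ∘ m , h ⟩
        A⊗k∘u : A⊗k ∘ u ≈ m
        A⊗k∘u = ⊗-ext (htrans project₁∘ project₁)
                      (begin
                        π₂ ∘ A⊗k ∘ u ≈⟨ project₂∘ ⟩
                        (k ∘ π₂) ∘ u ≈⟨ htrans assoc (∘ˡ project₂) ⟩
                        k ∘ h        ≈⟨ eq ⟩
                        π₂ ∘ m ∎)
        uniq : ∀ (v : Hom X (A ⊗ Z)) → π₂ ∘ v ≈ h → A⊗k ∘ v ≈ m → v ≈ u
        uniq v e₁ e₂ = unique (htrans (hsym project₁∘) (∘ˡ e₂)) e₁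

    beck-chevalley-π₂ : ∀ (x : Pred Z) → π₂ * Ex k x ≋ Ex A⊗k (π₂ * x)
    beck-chevalley-π₂ x = beck-chevalley k π₂ π₂ A⊗k isPullback x

  -- the kernel pair of a monomorphism is trivial, so ι* ∃_ι = id
  module _ {X A : Obj} (ι : Hom X A)
           (mono : ∀ {W} (h k : Hom W X) → ι ∘ h ≈ ι ∘ k → h ≈ k) where
    mono-pullback : IsPullback ι ι id id
    mono-pullback = record { commute = hrefl ; universal = λ h k eq →
      h , identityˡ , htrans identityˡ (mono h k eq) , λ v e₁ _ → htrans (hsym identityˡ) e₁ }

    *-Ex-mono : ∀ (x : Pred X) → ι * Ex ι x ≋ x
    *-Ex-mono x = ≋-trans (beck-chevalley ι ι id id mono-pullback x) (≋-trans Ex-id (*-id x))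

  compose-mono : ∀ {A B C'} {G G' : Pred (B ⊗ C')} {F F' : Pred (A ⊗ B)} →
                 G ⊑ G' → F ⊑ F' → compose G F ⊑ compose G' F'
  compose-mono g f = Ex-mono pAC (⊓-mono (*-mono pAB f) (*-mono π₂ g))

  compose-cong : ∀ {A B C'} {G G' : Pred (B ⊗ C')} {F F' : Pred (A ⊗ B)} →
                 G ≋ G' → F ≋ F' → compose G F ≋ compose G' F'
  compose-cong g f = ⊑-antisym (compose-mono (≋⇒⊑ g) (≋⇒⊑ f)) (compose-mono (≋⇒⊒ g) (≋⇒⊒ f))

  -- Composing with the relation  {(k₁ z, k₂ z) | z : Z} = ∃_k ⊤  eliminates the
  -- existential over the middle variable (Beck–Chevalley + Frobenius).
  compose-span₁ : ∀ {Z A B C'} (k : Hom Z (A ⊗ B)) (G : Pred (B ⊗ C')) →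
                  compose G (Ex k ⊤') ≋ Ex ⟨ π₁ ∘ k ∘ π₁ , π₂ ⟩ (⟨ π₂ ∘ k ∘ π₁ , π₂ ⟩ * G)
  compose-span₁ k G =
    ≋-trans (Ex-≋ (⊓-cong (≋-trans (beck-chevalley-pAB ⊤') (Ex-≋ *⊤)) ≋-refl))
    (≋-trans (Ex-≋ (≋-trans ⊓-comm (frob⊤ k⊗C)))
    (≋-trans (≋-sym Ex∘)
    (≋-trans (Ex-≈ pAC∘k⊗C) (Ex-≋ (≋-trans *-fuse (*-≈ project₂))))))
    where
    open PullbackAlongPAB k
    pAC∘k⊗C : pAC ∘ k⊗C ≈ ⟨ π₁ ∘ k ∘ π₁ , π₂ ⟩
    pAC∘k⊗C = htrans ⟨⟩∘ (⟨⟩-cong project₁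
                (htrans assoc (htrans (∘ˡ project₂) project₂)))

  compose-span₂ : ∀ {Z A B C'} (k : Hom Z (B ⊗ C')) (F : Pred (A ⊗ B)) →
                  compose (Ex k ⊤') F ≋ Ex ⟨ π₁ , π₂ ∘ k ∘ π₂ ⟩ (⟨ π₁ , π₁ ∘ k ∘ π₂ ⟩ * F)
  compose-span₂ {B = B} {C'} k F =
    ≋-trans (Ex-≋ (⊓-cong ≋-refl (≋-trans (beck-chevalley-π₂ ⊤') (Ex-≋ *⊤))))
    (≋-trans (Ex-≋ (frob⊤ A⊗k))
    (≋-trans (≋-sym Ex∘)
    (≋-trans (Ex-≈ (through π₂)) (Ex-≋ (≋-trans *-fuse (*-≈ (through π₁)))))))
    where
    open PullbackAlongπ₂ k
    through : ∀ {T} (t : Hom (B ⊗ C') T) → ⟨ π₁ , t ∘ π₂ ⟩ ∘ A⊗k ≈ ⟨ π₁ , t ∘ k ∘ π₂ ⟩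
    through t = htrans ⟨⟩∘ (⟨⟩-cong project₁ (htrans assoc (∘ˡ project₂)))

  compose-identityʳ : ∀ {A B} (G : Pred (A ⊗ B)) → compose G (δ A) ≋ G
  compose-identityʳ G = ≋-trans (compose-span₁ Δ G)
    (≋-trans (Ex-id≈ (htrans (⟨⟩-cong (htrans project₁∘ identityˡ) hrefl) ⟨⟩-id))
             (*-id≈ (htrans (⟨⟩-cong (htrans project₂∘ identityˡ) hrefl) ⟨⟩-id)))

  compose-identityˡ : ∀ {A B} (F : Pred (A ⊗ B)) → compose (δ B) F ≋ F
  compose-identityˡ F = ≋-trans (compose-span₂ Δ F)
    (≋-trans (Ex-id≈ (htrans (⟨⟩-cong hrefl (htrans project₂∘ identityˡ)) ⟨⟩-id))
             (*-id≈ (htrans (⟨⟩-cong hrefl (htrans project₁∘ identityˡ)) ⟨⟩-id)))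

  compose-cograph : ∀ {Y Z W} (f : Hom Y W) (F : Pred (Z ⊗ W)) →
                    compose (Ex ⟨ f , id ⟩ ⊤') F ≋ (id ⁂ f) * F
  compose-cograph f F = ≋-trans (compose-span₂ ⟨ f , id ⟩ F)
    (≋-trans (Ex-id≈ (htrans (⟨⟩-cong hrefl (htrans project₂∘ identityˡ)) ⟨⟩-id))
             (*-≈ (⟨⟩-cong (hsym identityˡ) project₁∘)))

  compose-graph : ∀ {Y A C'} (f : Hom Y A) (G : Pred (A ⊗ C')) →
                  compose G (Ex ⟨ id , f ⟩ ⊤') ≋ (f ⁂ id) * G
  compose-graph f G = ≋-trans (compose-span₁ ⟨ id , f ⟩ G)
    (≋-trans (Ex-id≈ (htrans (⟨⟩-cong (htrans project₁∘ identityˡ) hrefl) ⟨⟩-id))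
             (*-≈ (⟨⟩-cong project₂∘ (hsym identityˡ))))

  Γ-Ex : ∀ {Y A} (f : Hom Y A) → Γ f ≋ Ex ⟨ id , f ⟩ ⊤'
  Γ-Ex f = ≋-sym (≋-trans (≋-sym (compose-identityˡ _)) (compose-graph f (δ _)))

  coΓ-Ex : ∀ {Y A} (f : Hom Y A) → Ex ⟨ f , id ⟩ ⊤' ≋ (id ⁂ f) * δ A
  coΓ-Ex f = ≋-trans (≋-sym (compose-identityʳ _)) (compose-cograph f (δ _))

  conv : ∀ {A B} → Pred (A ⊗ B) → Pred (B ⊗ A)
  conv F = swap * F

  conv-Ex : ∀ {Z A B} (k : Hom Z (A ⊗ B)) {x : Pred Z} → conv (Ex k x) ≋ Ex (swap ∘ k) x
  conv-Ex k = ≋-sym (≋-trans Ex∘ (Ex-iso swap∘swap swap∘swap))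

  conv-conv : ∀ {A B} {F : Pred (A ⊗ B)} → conv (conv F) ≋ F
  conv-conv = ≋-trans *-fuse (*-id≈ swap∘swap)

  conv-δ : ∀ {A} → conv (δ A) ≋ δ A
  conv-δ = ≋-trans (conv-Ex Δ) (Ex-≈ swap∘⟨⟩)

  reverse : ∀ {A B C'} → Hom (A ⊗ (B ⊗ C')) (C' ⊗ (B ⊗ A))
  reverse = ⟨ π₂ ∘ π₂ , ⟨ π₁ ∘ π₂ , π₁ ⟩ ⟩

  module _ {A B C' : Obj} where
    reverse-π₁ : π₁ ∘ reverse {A} {B} {C'} ≈ π₂ ∘ π₂
    reverse-π₁ = project₁

    reverse-π₁π₂ : π₁ ∘ π₂ ∘ reverse {A} {B} {C'} ≈ π₁ ∘ π₂
    reverse-π₁π₂ = htrans (∘ˡ project₂) project₁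

    reverse-π₂π₂ : π₂ ∘ π₂ ∘ reverse {A} {B} {C'} ≈ π₁
    reverse-π₂π₂ = htrans (∘ˡ project₂) project₂

    reverse-involutive : reverse {C'} {B} {A} ∘ reverse {A} {B} {C'} ≈ id
    reverse-involutive = htrans ⟨⟩∘ (htrans (⟨⟩-cong (htrans assoc reverse-π₂π₂)
      (htrans ⟨⟩∘ (⟨⟩-cong (htrans assoc reverse-π₁π₂) reverse-π₁)))
      (htrans (⟨⟩-cong hrefl ⟨⟩-η) ⟨⟩-id))

  conv-compose : ∀ {A B C'} (G : Pred (B ⊗ C')) (F : Pred (A ⊗ B)) →
                 conv (compose G F) ≋ compose (conv F) (conv G)
  conv-compose {A} {B} {C'} G F = ≋-trans (conv-Ex pAC)
    (≋-sym (≋-trans (Ex-reindex-iso (reverse-involutive {C'} {B} {A})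
                                    (reverse-involutive {A} {B} {C'}) pAC _)
      (≋-trans (Ex-≈ pAC∘reverse)
        (Ex-≋ (≋-trans *⊓ (≋-trans (⊓-cong (≋-trans *-fuse₃ (*-≈ convF∘reverse))
                                           (≋-trans *-fuse₃ (*-≈ convG∘reverse))) ⊓-comm))))))
    where
    open HomReasoning
    pAC∘reverse : pAC ∘ reverse ≈ swap ∘ pAC
    pAC∘reverse = begin
      pAC ∘ reverse                      ≈⟨ ⟨⟩∘ ⟩
      ⟨ π₁ ∘ reverse , (π₂ ∘ π₂) ∘ reverse ⟩ ≈⟨ ⟨⟩-cong reverse-π₁ (htrans assoc reverse-π₂π₂) ⟩
      ⟨ π₂ ∘ π₂ , π₁ ⟩                   ≈⟨ hsym swap∘⟨⟩ ⟩
      swap ∘ pAC ∎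
    convF∘reverse : (swap ∘ pAB) ∘ reverse ≈ π₂
    convF∘reverse = begin
      (swap ∘ pAB) ∘ reverse ≈⟨ assoc ⟩
      swap ∘ pAB ∘ reverse   ≈⟨ ∘ˡ (htrans ⟨⟩∘ (⟨⟩-cong reverse-π₁ (htrans assoc reverse-π₁π₂))) ⟩
      swap ∘ ⟨ π₂ ∘ π₂ , π₁ ∘ π₂ ⟩ ≈⟨ swap∘⟨⟩ ⟩
      ⟨ π₁ ∘ π₂ , π₂ ∘ π₂ ⟩ ≈⟨ ⟨⟩-η ⟩
      π₂ ∎
    convG∘reverse : (swap ∘ π₂) ∘ reverse ≈ pAB
    convG∘reverse = begin
      (swap ∘ π₂) ∘ reverse ≈⟨ assoc ⟩
      swap ∘ π₂ ∘ reverse   ≈⟨ ∘ˡ project₂ ⟩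
      swap ∘ ⟨ π₁ ∘ π₂ , π₁ ⟩ ≈⟨ swap∘⟨⟩ ⟩
      pAB ∎

  -- Both sides of  H ∘ (G ∘ F)  and  (H ∘ G) ∘ F  are, after
  -- Beck–Chevalley and Frobenius, an ∃ over the four-fold products
  --   W₁ = (A ⊗ (B ⊗ C)) ⊗ D   and   W₂ = A ⊗ (B ⊗ (C ⊗ D));
  -- transporting along the canonical isomorphism W₂ ≅ W₁ identifies them.
  module Associativity {A B C' D' : Obj} where

    W₁ W₂ : Obj
    W₁ = (A ⊗ (B ⊗ C')) ⊗ D'
    W₂ = A ⊗ (B ⊗ (C' ⊗ D'))

    abc : Hom W₂ (A ⊗ (B ⊗ C'))
    abc = ⟨ π₁ , ⟨ π₁ ∘ π₂ , π₁ ∘ π₂ ∘ π₂ ⟩ ⟩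

    reassoc : Hom W₂ W₁
    reassoc = ⟨ abc , π₂ ∘ π₂ ∘ π₂ ⟩

    reassoc⁻¹ : Hom W₁ W₂
    reassoc⁻¹ = ⟨ π₁ ∘ π₁ , ⟨ π₁ ∘ π₂ ∘ π₁ , ⟨ π₂ ∘ π₂ ∘ π₁ , π₂ ⟩ ⟩ ⟩

    left : Hom W₁ (A ⊗ (C' ⊗ D'))
    left = PullbackAlongPAB.k⊗C (pAC {A} {B} {C'})

    right : Hom W₂ (A ⊗ (B ⊗ D'))
    right = PullbackAlongπ₂.A⊗k (pAC {B} {C'} {D'})

    reassoc⁻¹∘reassoc : reassoc⁻¹ ∘ reassoc ≈ id
    reassoc⁻¹∘reassoc = begin
      reassoc⁻¹ ∘ reassoc ≈⟨ ⟨⟩∘ ⟩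
      ⟨ (π₁ ∘ π₁) ∘ reassoc , ⟨ π₁ ∘ π₂ ∘ π₁ , ⟨ π₂ ∘ π₂ ∘ π₁ , π₂ ⟩ ⟩ ∘ reassoc ⟩
        ≈⟨ ⟨⟩-cong (htrans assoc (htrans (∘ˡ project₁) project₁))
                   (htrans ⟨⟩∘ (⟨⟩-cong
                      (htrans assoc₃ (htrans (∘ˡ (∘ˡ project₁)) (htrans (∘ˡ project₂) project₁)))
                      (htrans ⟨⟩∘ (⟨⟩-cong
                        (htrans assoc₃ (htrans (∘ˡ (∘ˡ project₁)) (htrans (∘ˡ project₂) project₂)))
                        project₂)))) ⟩
      ⟨ π₁ , ⟨ π₁ ∘ π₂ , ⟨ π₁ ∘ π₂ ∘ π₂ , π₂ ∘ π₂ ∘ π₂ ⟩ ⟩ ⟩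
        ≈⟨ ⟨⟩-cong hrefl (⟨⟩-cong hrefl ⟨⟩-η) ⟩
      ⟨ π₁ , ⟨ π₁ ∘ π₂ , π₂ ∘ π₂ ⟩ ⟩ ≈⟨ ⟨⟩-cong hrefl ⟨⟩-η ⟩
      ⟨ π₁ , π₂ ⟩ ≈⟨ ⟨⟩-id ⟩
      id ∎
      where open HomReasoning

    reassoc∘reassoc⁻¹ : reassoc ∘ reassoc⁻¹ ≈ id
    reassoc∘reassoc⁻¹ = begin
      reassoc ∘ reassoc⁻¹ ≈⟨ ⟨⟩∘ ⟩
      ⟨ abc ∘ reassoc⁻¹ , (π₂ ∘ π₂ ∘ π₂) ∘ reassoc⁻¹ ⟩
        ≈⟨ ⟨⟩-cong (htrans ⟨⟩∘ (⟨⟩-cong project₁ (htrans ⟨⟩∘ (⟨⟩-cong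
               (htrans assoc (htrans (∘ˡ project₂) project₁))
               (htrans assoc₃ (htrans (∘ˡ (∘ˡ project₂)) (htrans (∘ˡ project₂) project₁)))))))
             (htrans assoc₃ (htrans (∘ˡ (∘ˡ project₂)) (htrans (∘ˡ project₂) project₂))) ⟩
      ⟨ ⟨ π₁ ∘ π₁ , ⟨ π₁ ∘ π₂ ∘ π₁ , π₂ ∘ π₂ ∘ π₁ ⟩ ⟩ , π₂ ⟩
        ≈⟨ ⟨⟩-cong (⟨⟩-cong hrefl ⟨⟩-η) hrefl ⟩
      ⟨ ⟨ π₁ ∘ π₁ , π₂ ∘ π₁ ⟩ , π₂ ⟩ ≈⟨ ⟨⟩-cong ⟨⟩-η hrefl ⟩
      ⟨ π₁ , π₂ ⟩ ≈⟨ ⟨⟩-id ⟩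
      id ∎
      where open HomReasoning

    left∘reassoc : left ∘ reassoc ≈ ⟨ π₁ , ⟨ π₁ ∘ π₂ ∘ π₂ , π₂ ∘ π₂ ∘ π₂ ⟩ ⟩
    left∘reassoc = htrans ⟨⟩∘ (⟨⟩-cong
      (htrans assoc₃ (htrans (∘ˡ (∘ˡ project₁)) (htrans project₁∘ project₁)))
      (htrans ⟨⟩∘ (⟨⟩-cong
        (htrans assoc₃ (htrans (∘ˡ (∘ˡ project₁))
          (htrans project₂∘ (htrans assoc (htrans (∘ˡ project₂) project₂)))))
        project₂)))

    outer : (pAC ∘ left) ∘ reassoc ≈ pAC ∘ right
    outer = begin
      (pAC ∘ left) ∘ reassoc ≈⟨ htrans assoc (∘ˡ left∘reassoc) ⟩
      pAC ∘ ⟨ π₁ , ⟨ π₁ ∘ π₂ ∘ π₂ , π₂ ∘ π₂ ∘ π₂ ⟩ ⟩ ≈⟨ ⟨⟩∘ ⟩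
      ⟨ π₁ ∘ _ , (π₂ ∘ π₂) ∘ _ ⟩ ≈⟨ ⟨⟩-cong project₁ (htrans assoc (htrans (∘ˡ project₂) project₂)) ⟩
      ⟨ π₁ , π₂ ∘ π₂ ∘ π₂ ⟩ ≈⟨ ⟨⟩-cong (hsym project₁)
           (hsym (htrans assoc (htrans (∘ˡ project₂) (htrans project₂∘ assoc)))) ⟩
      ⟨ π₁ ∘ right , (π₂ ∘ π₂) ∘ right ⟩ ≈⟨ hsym ⟨⟩∘ ⟩
      pAC ∘ right ∎
      where open HomReasoning

    factor-H : (π₂ ∘ left) ∘ reassoc ≈ π₂ ∘ π₂
    factor-H = htrans assoc (htrans (∘ˡ left∘reassoc) (htrans project₂ ⟨⟩-η))

    factor-F : (pAB ∘ π₁) ∘ reassoc ≈ pAB ∘ right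
    factor-F = begin
      (pAB ∘ π₁) ∘ reassoc ≈⟨ htrans assoc (∘ˡ project₁) ⟩
      pAB ∘ abc ≈⟨ ⟨⟩∘ ⟩
      ⟨ π₁ ∘ abc , (π₁ ∘ π₂) ∘ abc ⟩ ≈⟨ ⟨⟩-cong project₁ (htrans assoc (htrans (∘ˡ project₂) project₁)) ⟩
      ⟨ π₁ , π₁ ∘ π₂ ⟩ ≈⟨ ⟨⟩-cong (hsym project₁)
           (hsym (htrans assoc (htrans (∘ˡ project₂) project₁∘))) ⟩
      ⟨ π₁ ∘ right , (π₁ ∘ π₂) ∘ right ⟩ ≈⟨ hsym ⟨⟩∘ ⟩
      pAB ∘ right ∎
      where open HomReasoning

    factor-G : (π₂ ∘ π₁) ∘ reassoc ≈ pAB ∘ π₂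
    factor-G = begin
      (π₂ ∘ π₁) ∘ reassoc ≈⟨ htrans assoc (∘ˡ project₁) ⟩
      π₂ ∘ abc ≈⟨ project₂ ⟩
      ⟨ π₁ ∘ π₂ , π₁ ∘ π₂ ∘ π₂ ⟩ ≈⟨ ⟨⟩-cong hrefl sym-assoc ⟩
      ⟨ π₁ ∘ π₂ , (π₁ ∘ π₂) ∘ π₂ ⟩ ≈⟨ hsym ⟨⟩∘ ⟩
      pAB ∘ π₂ ∎
      where open HomReasoning

    compose-assoc : (F : Pred (A ⊗ B)) (G : Pred (B ⊗ C')) (H : Pred (C' ⊗ D')) →
                    compose H (compose G F) ≋ compose (compose H G) F
    compose-assoc F G H = ≋-trans nested-right (≋-sym nested-left)
      where
      FG : Pred (A ⊗ (B ⊗ C'))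
      FG = pAB * F ⊓ π₂ * G
      GH : Pred (B ⊗ (C' ⊗ D'))
      GH = pAB * G ⊓ π₂ * H
      body₁ : Pred W₁
      body₁ = left * (π₂ * H) ⊓ π₁ * FG
      body₂ : Pred W₂
      body₂ = right * (pAB * F) ⊓ π₂ * GH
      transport : reassoc * body₁ ≋ body₂
      transport = begin
        reassoc * body₁ ≈⟨ ≋-trans *⊓ (⊓-cong ≋-refl (≋-trans (*-≋ *⊓) *⊓)) ⟩
        reassoc * (left * (π₂ * H)) ⊓ (reassoc * (π₁ * (pAB * F)) ⊓ reassoc * (π₁ * (π₂ * G)))
          ≈⟨ ⊓-cong (≋-trans *-fuse₃ (*-≈ factor-H))
                    (⊓-cong (≋-trans *-fuse₃ (*-≈ factor-F)) (≋-trans *-fuse₃ (*-≈ factor-G))) ⟩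
        (π₂ ∘ π₂) * H ⊓ ((pAB ∘ right) * F ⊓ (pAB ∘ π₂) * G) ≈⟨ ⊓-rotate ⟩
        (pAB ∘ right) * F ⊓ ((pAB ∘ π₂) * G ⊓ (π₂ ∘ π₂) * H)
          ≈⟨ ⊓-cong (≋-sym *-fuse) (≋-trans (⊓-cong (≋-sym *-fuse) (≋-sym *-fuse)) (≋-sym *⊓)) ⟩
        body₂ ∎
        where open PredReasoning
      nested-right : compose H (compose G F) ≋ Ex (pAC ∘ right) body₂
      nested-right =
        ≋-trans (Ex-≋ (⊓-cong (PullbackAlongPAB.beck-chevalley-pAB pAC FG) ≋-refl))
        (≋-trans (Ex-≋ (≋-trans ⊓-comm (≋-sym (frob left))))
        (≋-trans (≋-sym Ex∘)
        (≋-trans (Ex-reindex-iso reassoc∘reassoc⁻¹ reassoc⁻¹∘reassoc (pAC ∘ left) body₁)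
        (≋-trans (Ex-≈ outer) (Ex-≋ transport)))))
      nested-left : compose (compose H G) F ≋ Ex (pAC ∘ right) body₂
      nested-left =
        ≋-trans (Ex-≋ (⊓-cong ≋-refl (PullbackAlongπ₂.beck-chevalley-π₂ pAC GH)))
        (≋-trans (Ex-≋ (≋-sym (frob right))) (≋-sym Ex∘))

  open Associativity using (compose-assoc)

  -- Functional relations are closed under composition
  -- Single-valuedness is stated pointwise in IsFunctional; relation-algebraically
  -- it reads  F ∘ F° ≤ δ,  a form that composes well.

  SingleValued : ∀ {Y A} → Pred (Y ⊗ A) → Set r
  SingleValued {Y} {A} F = pAB * F ⊓ pAC * F ⊑ ⟨ π₁ ∘ π₂ {Y} , π₂ ∘ π₂ {Y} ⟩ * δ A

  SingleValuedᴿ : ∀ {Y A} → Pred (Y ⊗ A) → Set r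
  SingleValuedᴿ {Y} {A} F = compose F (conv F) ⊑ δ A

  -- (x,y,z) ↦ (y,x,z): identifies the domain of F ∘ F° with that of the
  -- pointwise formula
  exchange : ∀ {X Y Z} → Hom (X ⊗ (Y ⊗ Z)) (Y ⊗ (X ⊗ Z))
  exchange = ⟨ π₁ ∘ π₂ , ⟨ π₁ , π₂ ∘ π₂ ⟩ ⟩

  module _ {X Y Z : Obj} where
    pAB∘exchange : pAB ∘ exchange {X} {Y} {Z} ≈ ⟨ π₁ ∘ π₂ , π₁ ⟩
    pAB∘exchange = htrans ⟨⟩∘ (⟨⟩-cong project₁ (htrans assoc (htrans (∘ˡ project₂) project₁)))

    pAC∘exchange : pAC ∘ exchange {X} {Y} {Z} ≈ ⟨ π₁ ∘ π₂ , π₂ ∘ π₂ ⟩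
    pAC∘exchange = htrans ⟨⟩∘ (⟨⟩-cong project₁ (htrans assoc (htrans (∘ˡ project₂) project₂)))

    π₂₂∘exchange : ⟨ π₁ ∘ π₂ , π₂ ∘ π₂ ⟩ ∘ exchange {X} {Y} {Z} ≈ pAC
    π₂₂∘exchange = htrans ⟨⟩∘ (⟨⟩-cong (htrans assoc (htrans (∘ˡ project₂) project₁))
                                       (htrans assoc (htrans (∘ˡ project₂) project₂)))

  SingleValued⇒ᴿ : ∀ {Y A} {F : Pred (Y ⊗ A)} → SingleValued F → SingleValuedᴿ F
  SingleValued⇒ᴿ h = Ex-adj₂ pAC _ _
    (⊑-trans (≋⇒⊑ (⊓-cong (≋-trans *-fuse (*-≈ (htrans swap∘⟨⟩ (hsym pAB∘exchange))))
                          (*-≈ (hsym (htrans pAC∘exchange ⟨⟩-η)))))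
    (⊑-trans (≋⇒⊑ (⊓-cong (≋-sym *-fuse) (≋-sym *-fuse)))
    (⊑-trans (≋⇒⊒ *⊓)
    (⊑-trans (*-mono exchange h)
    (≋⇒⊑ (≋-trans *-fuse (*-≈ π₂₂∘exchange)))))))

  ᴿ⇒SingleValued : ∀ {Y A} {F : Pred (Y ⊗ A)} → SingleValuedᴿ F → SingleValued F
  ᴿ⇒SingleValued h =
    ⊑-trans (≋⇒⊑ (⊓-cong (*-≈ (hsym (htrans assoc (htrans (∘ˡ pAB∘exchange) swap∘⟨⟩))))
                         (*-≈ (hsym project₂))))
    (⊑-trans (≋⇒⊑ (⊓-cong (≋-sym *-fuse₃) (≋-sym *-fuse)))
    (⊑-trans (≋⇒⊒ *⊓)
    (⊑-trans (*-mono exchange (Ex-adj₁ pAC _ _ h))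
    (≋⇒⊑ (≋-trans *-fuse (*-≈ pAC∘exchange))))))

  single-valued-compose : ∀ {A B C'} {F : Pred (A ⊗ B)} {G : Pred (B ⊗ C')} →
                          SingleValuedᴿ F → SingleValuedᴿ G → SingleValuedᴿ (compose G F)
  single-valued-compose {F = F} {G} hF hG =
    ⊑-trans (≋⇒⊑ (compose-cong ≋-refl (conv-compose G F)))
    (⊑-trans (≋⇒⊑ (compose-assoc (conv G) (conv F) (compose G F)))
    (⊑-trans (compose-mono (≋⇒⊒ (compose-assoc (conv F) F G)) ⊑-refl)
    (⊑-trans (compose-mono (compose-mono ⊑-refl hF) ⊑-refl)
    (⊑-trans (compose-mono (≋⇒⊑ (compose-identityʳ G)) ⊑-refl) hG))))

  total-compose : ∀ {A B C'} {F : Pred (A ⊗ B)} {G : Pred (B ⊗ C')} →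
                  Ex π₁ F ≋ ⊤' → Ex π₁ G ≋ ⊤' → Ex π₁ (compose G F) ≋ ⊤'
  total-compose {A} {F = F} {G} totalF totalG =
    ≋-trans (≋-sym Ex∘)
    (≋-trans (Ex-≈ (htrans project₁ (hsym project₁)))
    (≋-trans Ex∘
    (≋-trans (Ex-≋ (≋-trans (frob pAB) (⊓-cong ≋-refl G-defined)))
    (≋-trans (Ex-≋ ⊓-⊤) totalF))))
    where
    G-defined : Ex pAB (π₂ * G) ≋ ⊤'
    G-defined = ≋-trans (≋-sym (PullbackAlongπ₂.beck-chevalley-π₂ {A = A} π₁ G))
                        (≋-trans (*-≋ totalG) *⊤)

  functional-compose : ∀ {A B C'} {F : Pred (A ⊗ B)} {G : Pred (B ⊗ C')} →
                       IsFunctional A B F → IsFunctional B C' G → IsFunctional A C' (compose G F)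
  functional-compose (svF , totalF) (svG , totalG) =
    ᴿ⇒SingleValued (single-valued-compose (SingleValued⇒ᴿ svF) (SingleValued⇒ᴿ svG)) ,
    total-compose totalF totalG

  functional-resp : ∀ {A B} {F F' : Pred (A ⊗ B)} → F ≋ F' → IsFunctional A B F → IsFunctional A B F'
  functional-resp e (svF , totalF) =
    ⊑-trans (⊓-mono (≋⇒⊒ (*-≋ e)) (≋⇒⊒ (*-≋ e))) svF , ≋-trans (Ex-≋ (≋-sym e)) totalF

  δ-preserved : ∀ {A B} (f : Hom A B) → δ A ⊑ (f ⁂ f) * δ B
  δ-preserved f = Ex-adj₂ Δ _ _
    (⊑-trans (≋⇒⊒ *⊤) (⊑-trans (*-mono f (unit Δ))
      (≋⇒⊑ (≋-trans *-fuse (≋-trans (*-≈ (hsym ⁂∘Δ)) (≋-sym *-fuse))))))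

  subst-δ : ∀ {Y Z W} {u v : Hom Y W} (φ : Pred (Z ⊗ W)) → ⊤' ⊑ ⟨ u , v ⟩ * δ W →
            (id ⁂ u) * φ ⊑ (id ⁂ v) * φ
  subst-δ {u = u} {v} φ u=v =
    ⊑-trans (≋⇒⊒ (compose-cograph u φ))
      (⊑-trans (compose-mono cograph-u⊑cograph-v ⊑-refl) (≋⇒⊑ (compose-cograph v φ)))
    where
    cograph-u⊑cograph-v : Ex ⟨ u , id ⟩ ⊤' ⊑ Ex ⟨ v , id ⟩ ⊤'
    cograph-u⊑cograph-v = Ex-adj₂ _ _ _
      (⊑-trans u=v (≋⇒⊑ (≋-trans (*-≈ (hsym (htrans ⁂∘⟨⟩ (⟨⟩-cong identityˡ identityʳ))))
                          (≋-trans (≋-sym *-fuse) (*-≋ (≋-sym (coΓ-Ex v)))))))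

  δ-sym : ∀ {Y W} {u v : Hom Y W} → ⊤' ⊑ ⟨ u , v ⟩ * δ W → ⊤' ⊑ ⟨ v , u ⟩ * δ W
  δ-sym h = ⊑-trans h (≋⇒⊑ (≋-trans (*-≈ (hsym swap∘⟨⟩)) (≋-trans (≋-sym *-fuse) (*-≋ conv-δ))))

  Γ-reflexive : ∀ {Y A} (f : Hom Y A) → ⊤' ⊑ ⟨ id , f ⟩ * Γ f
  Γ-reflexive f = ⊑-trans (≋⇒⊒ *⊤) (⊑-trans (*-mono f (unit Δ))
                    (≋⇒⊑ (≋-trans *-fuse (≋-trans (*-≈ (hsym graph∘⟨id,f⟩)) (≋-sym *-fuse)))))
    where
    graph∘⟨id,f⟩ : (f ⁂ id) ∘ ⟨ id , f ⟩ ≈ Δ ∘ f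
    graph∘⟨id,f⟩ = htrans ⁂∘⟨⟩ (htrans (⟨⟩-cong identityʳ identityˡ)
                                      (hsym (htrans ⟨⟩∘ (⟨⟩-cong identityˡ identityˡ))))

  Γ-determines : ∀ {Y A} {f g : Hom Y A} → Γ g ≋ Γ f → ⊤' ⊑ ⟨ f , g ⟩ * δ A
  Γ-determines {f = f} {g} Γg=Γf = ⊑-trans (Γ-reflexive g)
    (≋⇒⊑ (≋-trans (*-≋ Γg=Γf) (≋-trans *-fuse (*-≈ (htrans ⁂∘⟨⟩ (⟨⟩-cong identityʳ identityˡ))))))

  -- Completion of an object by the image of its singleton map

  module Completion (S : HasSingletons) where
    open HasSingletons S
    open PowerObjects powerObjects

    ℙ-ext : ∀ {A Y} {u v : Hom Y (ℙ A)} → ⊤' ⊑ ⟨ u , v ⟩ * δ (ℙ A) → u ≈ v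
    ℙ-ext {A} {u = u} {v} u=v =
      htrans (⦅⦆-unique _ u (⊑-antisym (subst-δ (∈ A) (δ-sym u=v)) (subst-δ (∈ A) u=v)))
             (hsym (⦅⦆-unique _ v ≋-refl))

    module Image (A : Obj) where
      IsSingleton : Pred (ℙ A)
      IsSingleton = Ex (sing A) ⊤'

      open Comprehension (sing-image A) public using (X; factor) renaming (⌊α⌋ to ι; ⌊α⌋-⊤ to ι-⊤)

      s : Hom A X
      s = proj₁ (factor (sing A) (unit (sing A)))

      ι∘s : ι ∘ s ≈ sing A
      ι∘s = proj₁ (proj₂ (factor (sing A) (unit (sing A))))

      -- comprehension maps are monic, by uniqueness of factorizations
      ι-mono : ∀ {W} (h k : Hom W X) → ι ∘ h ≈ ι ∘ k → h ≈ k
      ι-mono h k ιh=ιk = htrans (through-ιk h ιh=ιk) (hsym (through-ιk k hrefl))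
        where
        ιk-singleton : ⊤' ⊑ (ι ∘ k) * IsSingleton
        ιk-singleton = ⊑-trans (≋⇒⊒ *⊤) (⊑-trans (*-mono k ι-⊤) (≋⇒⊑ *-fuse))
        through-ιk : ∀ v → ι ∘ v ≈ ι ∘ k → v ≈ proj₁ (factor (ι ∘ k) ιk-singleton)
        through-ιk v = proj₂ (proj₂ (factor (ι ∘ k) ιk-singleton)) v

      s-surjective : Ex s ⊤' ≋ ⊤'
      s-surjective = ⊤-unique (⊑-trans ι-⊤ (≋⇒⊑
        (≋-trans (*-≋ (Ex-≈ (hsym ι∘s))) (≋-trans (*-≋ Ex∘) (*-Ex-mono ι ι-mono _)))))

      s-injective : (s ⁂ s) * δ X ⊑ δ A
      s-injective = ⊑-trans (*-mono (s ⁂ s) (δ-preserved ι))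
        (≋⇒⊑ (≋-trans *-fuse (≋-trans (*-≈ (htrans ⁂∘⁂ (⁂-cong ι∘s ι∘s)))
               (≋-sym (sing-injective A)))))

      η : Pred (A ⊗ X)
      η = Ex ⟨ id , s ⟩ ⊤'

      ε : Pred (X ⊗ A)
      ε = Ex ⟨ s , id ⟩ ⊤'

      ε∘η : compose ε η ≋ δ A
      ε∘η = begin
        compose ε η        ≈⟨ compose-graph s ε ⟩
        (s ⁂ id) * ε       ≈⟨ *-≋ (coΓ-Ex s) ⟩
        (s ⁂ id) * (id ⁂ s) * δ X ≈⟨ ≋-trans *-fuse (*-≈ (htrans ⁂∘⁂ (⁂-cong identityˡ identityʳ))) ⟩
        (s ⁂ s) * δ X      ≈⟨ ⊑-antisym s-injective (δ-preserved s) ⟩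
        δ A ∎
        where open PredReasoning

      η∘ε : compose η ε ≋ δ X
      η∘ε = begin
        compose η ε ≈⟨ compose-span₁ ⟨ s , id ⟩ η ⟩
        Ex ⟨ π₁ ∘ ⟨ s , id ⟩ ∘ π₁ , π₂ ⟩ (⟨ π₂ ∘ ⟨ s , id ⟩ ∘ π₁ , π₂ ⟩ * η)
          ≈⟨ Ex-≋ (*-id≈ (htrans (⟨⟩-cong (htrans project₂∘ identityˡ) hrefl) ⟨⟩-id)) ⟩
        Ex ⟨ π₁ ∘ ⟨ s , id ⟩ ∘ π₁ , π₂ ⟩ (Ex ⟨ id , s ⟩ ⊤') ≈⟨ ≋-sym Ex∘ ⟩
        Ex (⟨ π₁ ∘ ⟨ s , id ⟩ ∘ π₁ , π₂ ⟩ ∘ ⟨ id , s ⟩) ⊤' ≈⟨ Ex-≈ diagonal-through-s ⟩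
        Ex (Δ ∘ s) ⊤'      ≈⟨ Ex∘ ⟩
        Ex Δ (Ex s ⊤')     ≈⟨ Ex-≋ s-surjective ⟩
        δ X ∎
        where
        open PredReasoning
        diagonal-through-s : ⟨ π₁ ∘ ⟨ s , id ⟩ ∘ π₁ , π₂ ⟩ ∘ ⟨ id , s ⟩ ≈ Δ ∘ s
        diagonal-through-s = htrans ⟨⟩∘ (htrans
          (⟨⟩-cong (htrans assoc₃ (htrans (∘ˡ (∘ˡ project₁)) (htrans (∘ˡ identityʳ) project₁)))
                   project₂)
          (hsym (htrans ⟨⟩∘ (⟨⟩-cong identityˡ identityˡ))))

      η-functional : IsFunctional A X η
      η-functional =
        ᴿ⇒SingleValued (≋⇒⊑ (≋-trans (compose-cong ≋-refl conv-η) η∘ε)) ,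
        ≋-trans (≋-sym Ex∘) (Ex-id≈ project₁)
        where
        conv-η : conv η ≋ ε
        conv-η = ≋-trans (conv-Ex _) (Ex-≈ swap∘⟨⟩)

      ε-functional : IsFunctional X A ε
      ε-functional =
        ᴿ⇒SingleValued (≋⇒⊑ (≋-trans (compose-cong ≋-refl conv-ε) ε∘η)) ,
        ≋-trans (≋-sym Ex∘) (≋-trans (Ex-≈ project₁) s-surjective)
        where
        conv-ε : conv ε ≋ η
        conv-ε = ≋-trans (conv-Ex _) (Ex-≈ swap∘⟨⟩)

      -- ε is an isomorphism, so post-composition with it is injective
      ε-cancel : ∀ {Y} {F F' : Pred (Y ⊗ X)} → compose ε F ≋ compose ε F' → F ≋ F'
      ε-cancel {F = F} {F'} εF=εF' = begin
        F                        ≈⟨ ≋-sym (compose-identityˡ F) ⟩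
        compose (δ X) F          ≈⟨ compose-cong (≋-sym η∘ε) ≋-refl ⟩
        compose (compose η ε) F  ≈⟨ ≋-sym (compose-assoc F ε η) ⟩
        compose η (compose ε F)  ≈⟨ compose-cong ≋-refl εF=εF' ⟩
        compose η (compose ε F') ≈⟨ compose-assoc F' ε η ⟩
        compose (compose η ε) F' ≈⟨ compose-cong η∘ε ≋-refl ⟩
        compose (δ X) F'         ≈⟨ compose-identityˡ F' ⟩
        F' ∎
        where open PredReasoning

      membership-is-graph : (id ⁂ ι) * ∈ A ≋ η
      membership-is-graph = ε-cancel (≋-trans ε∘membership (≋-sym ε∘η))
        where
        open PredReasoning
        ε∘membership : compose ε ((id ⁂ ι) * ∈ A) ≋ δ A
        ε∘membership = begin
          compose ε ((id ⁂ ι) * ∈ A) ≈⟨ compose-cograph s _ ⟩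
          (id ⁂ s) * (id ⁂ ι) * ∈ A  ≈⟨ ≋-trans *-fuse (*-≈ (htrans ⁂∘⁂ (⁂-cong identityˡ ι∘s))) ⟩
          (id ⁂ sing A) * ∈ A        ≈⟨ ≋-sym (⦅⦆-spec (δ A)) ⟩
          δ A ∎

      -- every functional relation H into A is ε reindexed along a map into X:
      -- its classifying map Y → ℙ(A) lands in the singletons (axiom (iii))
      classify : ∀ {Y} (H : Pred (Y ⊗ A)) → IsFunctional Y A H →
                 Σ[ f ∈ Hom Y X ] ((f ⁂ id) * ε ≋ H)
      classify {Y} H H-functional = f , ≋-sym H=f*ε
        where
        g : Hom Y (ℙ A)
        g = ⦅ swap * H ⦆
        H-classified : swap * ((id ⁂ g) * ∈ A) ≋ H
        H-classified = ≋-trans (*-≋ (≋-sym (⦅⦆-spec (swap * H)))) conv-conv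
        g-singleton : g * IsSingleton ≋ ⊤'
        g-singleton = sing-functional⇒ g (functional-resp (≋-sym H-classified) H-functional)
        f : Hom Y X
        f = proj₁ (factor g (≋⇒⊒ g-singleton))
        ι∘f : ι ∘ f ≈ g
        ι∘f = proj₁ (proj₂ (factor g (≋⇒⊒ g-singleton)))
        swap-naturality : (id ⁂ f) ∘ swap ≈ swap ∘ (f ⁂ id)
        swap-naturality = htrans ⟨⟩∘ (htrans
          (⟨⟩-cong (htrans assoc (htrans identityˡ project₁)) (htrans assoc (∘ˡ project₂)))
          (hsym (htrans swap∘⟨⟩ (⟨⟩-cong identityˡ hrefl))))
        H=f*ε : H ≋ (f ⁂ id) * ε
        H=f*ε = begin
          H                                  ≈⟨ ≋-sym H-classified ⟩
          swap * (id ⁂ g) * ∈ A              ≈⟨ *-≋ (*-≈ (htrans (⁂-cong (hsym identityˡ) (hsym ι∘f))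
                                                                   (hsym ⁂∘⁂))) ⟩
          swap * ((id ⁂ ι) ∘ (id ⁂ f)) * ∈ A ≈⟨ *-≋ (≋-trans (≋-sym *-fuse) (*-≋ membership-is-graph)) ⟩
          swap * (id ⁂ f) * η                ≈⟨ ≋-trans *-fuse (*-≈ swap-naturality) ⟩
          (swap ∘ (f ⁂ id)) * η              ≈⟨ ≋-trans (≋-sym *-fuse) (*-≋ (≋-trans (conv-Ex _) (Ex-≈ swap∘⟨⟩))) ⟩
          (f ⁂ id) * ε ∎
          where open PredReasoning

      -- maps into X are determined by their graphs (ι is monic and ℙ(A) extensional)
      Γ-injective : ∀ {Y} {f g : Hom Y X} → Γ g ≋ Γ f → g ≈ f
      Γ-injective {f = f} {g} Γg=Γf = ι-mono g f (hsym (ℙ-ext ιf=ιg))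
        where
        ιf=ιg : ⊤' ⊑ ⟨ ι ∘ f , ι ∘ g ⟩ * δ (ℙ A)
        ιf=ιg = ⊑-trans (Γ-determines Γg=Γf)
          (⊑-trans (*-mono _ (δ-preserved ι)) (≋⇒⊑ (≋-trans *-fuse (*-≈ ⁂∘⟨⟩))))

      X-complete : IsComplete X
      X-complete Y F F-functional = f , Γf=F , λ g Γg=F → Γ-injective (≋-trans Γg=F (≋-sym Γf=F))
        where
        classified : Σ[ f ∈ Hom Y X ] ((f ⁂ id) * ε ≋ compose ε F)
        classified = classify (compose ε F) (functional-compose F-functional ε-functional)
        f : Hom Y X
        f = proj₁ classified
        Γf=F : Γ f ≋ F
        Γf=F = ε-cancel (≋-trans (compose-cong ≋-refl (Γ-Ex f))
                        (≋-trans (compose-graph f ε) (proj₂ classified)))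

    open Image public

    conjugate : ∀ {A B} → Pred (A ⊗ B) → Pred (X A ⊗ X B)
    conjugate {A} {B} F = compose (η B) (compose F (ε A))

    conjugate-functional : ∀ {A B} {F : Pred (A ⊗ B)} →
                           IsFunctional A B F → IsFunctional (X A) (X B) (conjugate F)
    conjugate-functional {A} {B} F-functional =
      functional-compose (functional-compose (ε-functional A) F-functional) (η-functional B)

    conjugate-cong : ∀ {A B} {F F' : Pred (A ⊗ B)} → F ≋ F' → conjugate F ≋ conjugate F'
    conjugate-cong F=F' = compose-cong ≋-refl (compose-cong F=F' ≋-refl)

    conjugate-identity : ∀ {A} → conjugate (δ A) ≋ δ (X A)
    conjugate-identity {A} = ≋-trans (compose-cong ≋-refl (compose-identityˡ (ε A))) (η∘ε A)

    ε∘η-cancelˡ : ∀ {B Y} (R : Pred (Y ⊗ B)) → compose (ε B) (compose (η B) R) ≋ R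
    ε∘η-cancelˡ {B} R = ≋-trans (compose-assoc R (η B) (ε B))
                                (≋-trans (compose-cong (ε∘η B) ≋-refl) (compose-identityˡ R))

    ε∘η-cancelʳ : ∀ {A Y} (R : Pred (A ⊗ Y)) → compose (compose R (ε A)) (η A) ≋ R
    ε∘η-cancelʳ {A} R = ≋-trans (≋-sym (compose-assoc (η A) (ε A) R))
                                (≋-trans (compose-cong ≋-refl (ε∘η A)) (compose-identityʳ R))

    conjugate-compose : ∀ {A B C'} (F : Pred (A ⊗ B)) (G : Pred (B ⊗ C')) →
                        conjugate (compose G F) ≋ compose (conjugate G) (conjugate F)
    conjugate-compose {A} {B} {C'} F G = ≋-sym (begin
      compose (compose (η C') (compose G (ε B))) (conjugate F)
        ≈⟨ ≋-sym (compose-assoc (conjugate F) _ (η C')) ⟩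
      compose (η C') (compose (compose G (ε B)) (compose (η B) (compose F (ε A))))
        ≈⟨ compose-cong ≋-refl (≋-sym (compose-assoc _ (ε B) G)) ⟩
      compose (η C') (compose G (compose (ε B) (compose (η B) (compose F (ε A)))))
        ≈⟨ compose-cong ≋-refl (compose-cong ≋-refl (ε∘η-cancelˡ _)) ⟩
      compose (η C') (compose G (compose F (ε A)))
        ≈⟨ compose-cong ≋-refl (compose-assoc (ε A) F G) ⟩
      conjugate (compose G F) ∎)
      where open PredReasoning

    η-natural : ∀ {A B} (F : Pred (A ⊗ B)) → compose (η B) F ≋ compose (conjugate F) (η A)
    η-natural {A} {B} F = ≋-sym (≋-trans (≋-sym (compose-assoc (η A) _ (η B)))
                                         (compose-cong ≋-refl (ε∘η-cancelʳ F)))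

    ε-natural : ∀ {A B} (F : Pred (A ⊗ B)) → compose F (ε A) ≋ compose (ε B) (conjugate F)
    ε-natural F = ≋-sym (ε∘η-cancelˡ _)

corollary4p8 : ∀ {o ℓ e p q r : Level} (C : Category o ℓ e) (FP : FinProducts C)
    (D : Doctrine C p q r) (EE : ElementaryExistential C D) →
    Theory.HasSingletons FP EE →
    InclusionIsEquivalence FP EE
corollary4p8 C FP D EE S = record
  { G₀ = λ A → X A , X-complete A
  ; G₁ = λ F _ → conjugate F
  ; G-hom = λ _ F-functional → conjugate-functional F-functional
  ; G-resp-≈ = λ _ _ _ _ F=F' → conjugate-cong F=F'
  ; G-identity = λ _ → conjugate-identity
  ; G-homomorphism = λ F G _ _ _ → conjugate-compose F G
  ; η = λ A → η (proj₁ A)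
  ; η⁻¹ = λ A → ε (proj₁ A)
  ; η-hom = λ A → η-functional (proj₁ A)
  ; η⁻¹-hom = λ A → ε-functional (proj₁ A)
  ; η-isoˡ = λ A → ε∘η (proj₁ A)
  ; η-isoʳ = λ A → η∘ε (proj₁ A)
  ; η-natural = λ F _ → η-natural F
  ; ε = ε
  ; ε⁻¹ = η
  ; ε-hom = ε-functional
  ; ε⁻¹-hom = η-functional
  ; ε-isoˡ = η∘ε
  ; ε-isoʳ = ε∘η
  ; ε-natural = λ F _ → ε-natural F
  }
  where open Development.Completion C FP D EE S
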